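{- Let $n\ge2$. For every tree $T$ on $n$ vertices, $\mathscr{K}(T)\le\mathscr{K}(P_n)$, where $P_n$ is the path on $n$ vertices; that is, among all trees on $n$ vertices the path maximizes Kemeny's constant.
   Context: For a connected graph $H$ with $m\ge1$ edges and degrees $d_i$, Kemeny's constant is $\mathscr{K}(H)=\sum_j\pi_jm_{ij}$ for the simple random walk on $H$, where $\pi_j=d_j/2m$ and $m_{ij}$ is the expected hitting time of $j$ from $i$ ($m_{jj}=0$); equivalently $\mathscr{K}(H)=\frac1{4m}\sum_{i,j}d_id_jr_H(i,j)$, where $r_H$ is effective resistance (for a tree, $r_H(i,j)$ is the graph distance). -}

module Defs where

open import Data.Nat as ℕ using (ℕ; zero; suc; _+_; _*_; _≤_; _≡ᵇ_; _<ᵇ_)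
open import Data.Fin using (Fin; toℕ)
open import Data.Fin.Properties using (_≟_)
open import Data.Bool using (Bool; true; false; _∧_; _∨_; if_then_else_)
open import Data.Bool.Properties using (∨-comm)
open import Data.List using (List; []; _∷_; _++_; [_]; length; map; allFin)
open import Data.Nat.ListAction using (sum)
open import Data.Bool.ListAction using (any)
open import Data.Unit using (⊤)
open import Data.List.Relation.Unary.Unique.Propositional using (Unique)
open import Data.Product using (Σ; ∃; _×_)
open import Data.Integer using (+_)
open import Data.Rational using (ℚ; _/_; 0ℚ)
open import Relation.Nullary using (¬_)
open import Relation.Nullary.Decidable using (⌊_⌋)
open import Relation.Binary.PropositionalEquality using (_≡_; refl)

record SimpleGraph (n : ℕ) : Set where
  field
    adj    : Fin n → Fin n → Bool
    sym    : ∀ i j → adj i j ≡ adj j i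
    irrefl : ∀ i → adj i i ≡ false
open SimpleGraph public

module _ {n : ℕ} (G : SimpleGraph n) where

  Adj : Fin n → Fin n → Set
  Adj i j = adj G i j ≡ true

  data Walk : Fin n → Fin n → ℕ → Set where
    nil  : ∀ {i} → Walk i i 0
    cons : ∀ {i k j l} → Adj i k → Walk k j l → Walk i j (suc l)

  Connected : Set
  Connected = ∀ i j → ∃ λ l → Walk i j l

  Chain : List (Fin n) → Set
  Chain []           = ⊤
  Chain (x ∷ [])     = ⊤
  Chain (x ∷ y ∷ xs) = Adj x y × Chain (y ∷ xs)

  HasCycle : Set
  HasCycle = Σ (Fin n) λ v → Σ (List (Fin n)) λ vs →
    (2 ≤ length vs) × Unique (v ∷ vs) × Chain (v ∷ vs ++ [ v ])

  Acyclic : Set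
  Acyclic = ¬ HasCycle

  IsTree : Set
  IsTree = Connected × Acyclic

  deg : Fin n → ℕ
  deg i = sum (map (λ j → if adj G i j then 1 else 0) (allFin n))

  edges : ℕ
  edges = sum (map (λ i → sum (map (λ j → if (toℕ i <ᵇ toℕ j) ∧ adj G i j then 1 else 0)
                                    (allFin n))) (allFin n))

  reachWithin : ℕ → Fin n → Fin n → Bool
  reachWithin zero    i j = ⌊ i ≟ j ⌋
  reachWithin (suc k) i j = reachWithin k i j ∨ any (λ l → adj G i l ∧ reachWithin k l j) (allFin n)

  -- graph distance: least k with a walk of length k from i to j
  -- (searching k = 0,1,...,n; only meaningful for connected graphs, where dist ≤ n-1)
  dist : Fin n → Fin n → ℕ
  dist i j = go 0 n
    where
    go : ℕ → ℕ → ℕ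
    go k zero    = k
    go k (suc f) = if reachWithin k i j then k else go (suc k) f

  degDistSum : ℕ
  degDistSum = sum (map (λ i → sum (map (λ j → deg i * deg j * dist i j) (allFin n))) (allFin n))

  -- Kemeny's constant of a tree: (1/4m) Σ_{i,j} d_i d_j r(i,j), with r = graph distance
  -- for a tree. (Value 0 when m = 0, a case excluded by the paper's m ≥ 1.)
  kemenyTree : ℚ
  kemenyTree with 4 * edges
  ... | zero  = 0ℚ
  ... | suc d = (+ degDistSum) / suc d

private
  ≡ᵇ-suc : ∀ m → (m ≡ᵇ suc m) ≡ false
  ≡ᵇ-suc zero    = refl
  ≡ᵇ-suc (suc m) = ≡ᵇ-suc m

pathGraph : (n : ℕ) → SimpleGraph n
pathGraph n = record
  { adj    = λ i j → (toℕ i ≡ᵇ suc (toℕ j)) ∨ (toℕ j ≡ᵇ suc (toℕ i))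
  ; sym    = λ i j → ∨-comm (toℕ i ≡ᵇ suc (toℕ j)) (toℕ j ≡ᵇ suc (toℕ i))
  ; irrefl = λ i → irr (toℕ i)
  }
  where
  irr : ∀ m → ((m ≡ᵇ suc m) ∨ (m ≡ᵇ suc m)) ≡ false
  irr m rewrite ≡ᵇ-suc m = refl

{-# OPTIONS --safe #-}
-- Fix a root r of a tree on n = M + 1 vertices. Every other vertex has exactly one
-- neighbour one step closer to r, so Σ_j d_j dist(j,r) + M = 2 Σ_j dist(j,r). Weighting
-- this by d_r and summing over r gives Σ_{i,j} d_i d_j dist(i,j) = 4W − 2M² − 2nM, where
-- W = Σ_{i,j} dist(i,j) is the Wiener index. For the path, used only as a connected
-- graph (at least one such neighbour), the same count gives this with "≥". Both graphs
-- have M edges, so it remains to show W(G) ≤ W(P_n) for connected G: grow a vertex set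
-- U from one vertex, each time adding a neighbour w of some p ∈ U. Then
-- Σ_{u∈U} dist(w,u) ≤ |U| + Σ_{u∈U} dist(p,u), so the distance sums within U never
-- exceed those of a path on |U| vertices, and 3W(G) ≤ M(M+1)(M+2) ≤ 3W(P_n).
module Submission where

open import Defs hiding (sym)
open import Algebra.Properties.Semiring.Sum as Sum using ()
open import Data.Bool using (Bool; true; false; _∧_; _∨_; if_then_else_)
open import Data.Bool.ListAction using (any)
open import Data.Bool.Properties using (∧-zeroʳ; T-≡)
open import Data.Empty using (⊥-elim)
open import Data.Fin as Fin using (Fin; zero; suc; toℕ; fromℕ<)
open import Data.Fin.Properties as Fin using (_≟_)
open import Data.Integer using (+≤+) renaming (+_ to ℤ+)
import Data.Integer.Properties as ℤ
open import Data.List using (List; []; _∷_; _++_; [_]; length; map; tabulate; allFin)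
open import Data.List.Membership.Propositional using (_∈_)
open import Data.List.Membership.Propositional.Properties using (∈-allFin)
open import Data.List.Relation.Unary.All as All using (All; []; _∷_)
import Data.List.Relation.Unary.All.Properties as All
open import Data.List.Relation.Unary.AllPairs using ([]; _∷_)
import Data.List.Relation.Unary.AllPairs.Properties as AllPairs
open import Data.List.Relation.Unary.Any using (here; there)
open import Data.List.Relation.Unary.Unique.Propositional using (Unique)
open import Data.Nat using (ℕ; zero; suc; _+_; _*_; _∸_; _≤_; _<_; z≤n; s≤s; s≤s⁻¹; _≡ᵇ_; _<ᵇ_; ∣_-_∣)
import Data.Nat.ListAction as ListAction
open import Data.Nat.Properties hiding (_≟_)
open import Data.Nat.Tactic.RingSolver using (solve-∀)
open import Data.Product using (Σ; ∃; ∃₂; _×_; _,_; proj₁; proj₂)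
open import Data.Rational using (ℚ; _/_; 0ℚ) renaming (_≤_ to _≤ℚ_)
import Data.Rational.Properties as ℚ
open import Data.Rational.Unnormalised using (mkℚᵘ; *≤*)
import Data.Rational.Unnormalised.Properties as ℚᵘ
open import Data.Sum using (_⊎_; inj₁; inj₂)
open import Data.Unit using (tt)
open import Function using (_∘_; Equivalence)
open import Relation.Binary.PropositionalEquality hiding ([_])
open import Relation.Nullary using (yes; no)
open import Relation.Nullary.Decidable using (⌊_⌋)

open Sum +-*-semiring
  using (sum; sum-syntax; sum-cong-≗; ∑-distrib-+; ∑-comm; *-distribˡ-sum; *-distribʳ-sum)

sum-mono-≤ : ∀ {n} {f g : Fin n → ℕ} → (∀ i → f i ≤ g i) → sum f ≤ sum g
sum-mono-≤ {zero}  f≤g = z≤n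
sum-mono-≤ {suc n} f≤g = +-mono-≤ (f≤g zero) (sum-mono-≤ (f≤g ∘ suc))

sum-const : ∀ n c → ∑[ i < n ] c ≡ n * c
sum-const zero    c = refl
sum-const (suc n) c = cong (c +_) (sum-const n c)

sum-zero : ∀ {n} {f : Fin n → ℕ} → (∀ i → f i ≡ 0) → sum f ≡ 0
sum-zero {n} f≡0 = trans (sum-cong-≗ f≡0) (trans (sum-const n 0) (*-zeroʳ n))

sum-single : ∀ {n} (f : Fin n → ℕ) w → (∀ i → i ≢ w → f i ≡ 0) → sum f ≡ f w
sum-single f zero    f≡0 = trans (cong (f zero +_) (sum-zero λ i → f≡0 (suc i) λ ())) (+-identityʳ _)
sum-single f (suc w) f≡0 =
  cong₂ _+_ (f≡0 zero λ ()) (sum-single (f ∘ suc) w λ i i≢w → f≡0 (suc i) (i≢w ∘ Fin.suc-injective))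

term≤sum : ∀ {n} (f : Fin n → ℕ) i → f i ≤ sum f
term≤sum f zero    = m≤m+n _ _
term≤sum f (suc i) = ≤-trans (term≤sum (f ∘ suc) i) (m≤n+m _ _)

sum≤n : ∀ {n} {f : Fin n → ℕ} → (∀ i → f i ≤ 1) → sum f ≤ n
sum≤n {n} f≤1 = ≤-trans (sum-mono-≤ f≤1) (≤-reflexive (trans (sum-const n 1) (*-identityʳ n)))

sum<n : ∀ {n} {f : Fin n → ℕ} → (∀ i → f i ≤ 1) → ∀ w → f w ≡ 0 → sum f < n
sum<n f≤1 zero    fw≡0 rewrite fw≡0 = s≤s (sum≤n (f≤1 ∘ suc))
sum<n f≤1 (suc w) fw≡0 = +-mono-≤-< (f≤1 zero) (sum<n (f≤1 ∘ suc) w fw≡0)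

sum-map-tabulate : ∀ {A : Set} {n} (g : Fin n → A) (f : A → ℕ) →
                   ListAction.sum (map f (tabulate g)) ≡ ∑[ i < n ] f (g i)
sum-map-tabulate {n = zero}  g f = refl
sum-map-tabulate {n = suc n} g f = cong (f (g zero) +_) (sum-map-tabulate (g ∘ suc) f)

sum-map-allFin : ∀ {n} (f : Fin n → ℕ) → ListAction.sum (map f (allFin n)) ≡ sum f
sum-map-allFin f = sum-map-tabulate (λ i → i) f

∑∑-distrib-+ : ∀ {m n} (f g : Fin m → Fin n → ℕ) →
               ∑[ i < m ] ∑[ j < n ] (f i j + g i j) ≡ ∑[ i < m ] ∑[ j < n ] f i j + ∑[ i < m ] ∑[ j < n ] g i j
∑∑-distrib-+ {n = n} f g = trans (sum-cong-≗ λ i → ∑-distrib-+ (f i) (g i))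
                                 (∑-distrib-+ (λ i → ∑[ j < n ] f i j) (λ i → ∑[ j < n ] g i j))

𝟙 : Bool → ℕ
𝟙 b = if b then 1 else 0

𝟙≤1 : ∀ b → 𝟙 b ≤ 1
𝟙≤1 true  = ≤-refl
𝟙≤1 false = z≤n

∧-true⁻ : ∀ {a b} → a ∧ b ≡ true → a ≡ true × b ≡ true
∧-true⁻ {true} {true} _ = refl , refl

∨-true⁻ : ∀ {a b} → a ∨ b ≡ true → a ≡ true ⊎ b ≡ true
∨-true⁻ {true}  _      = inj₁ refl
∨-true⁻ {false} b≡true = inj₂ b≡true

∨-trueʳ : ∀ a {b} → b ≡ true → a ∨ b ≡ true
∨-trueʳ true  _      = refl
∨-trueʳ false b≡true = b≡true

≡ᵇ-true⁻ : ∀ {a b} → (a ≡ᵇ b) ≡ true → a ≡ b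
≡ᵇ-true⁻ {a} {b} e = ≡ᵇ⇒≡ a b (Equivalence.from T-≡ e)

≡ᵇ-refl : ∀ a → (a ≡ᵇ a) ≡ true
≡ᵇ-refl a = Equivalence.to T-≡ (≡⇒≡ᵇ a a refl)

any-witness : ∀ {A : Set} (p : A → Bool) xs → any p xs ≡ true → ∃ λ x → p x ≡ true
any-witness p (x ∷ xs) any≡true with p x in px
... | true  = x , px
... | false = any-witness p xs any≡true

any-intro : ∀ {A : Set} (p : A → Bool) {x} {xs} → x ∈ xs → p x ≡ true → any p xs ≡ true
any-intro p {xs = y ∷ _} (here refl) px rewrite px = refl
any-intro p {xs = y ∷ _} (there x∈xs) px = ∨-trueʳ (p y) (any-intro p x∈xs px)

module _ {n : ℕ} where

  ⌊≟⌋-refl : (i : Fin n) → ⌊ i ≟ i ⌋ ≡ true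
  ⌊≟⌋-refl i with i ≟ i
  ... | yes _  = refl
  ... | no i≢i = ⊥-elim (i≢i refl)

  ⌊≟⌋-true⁻ : {i j : Fin n} → ⌊ i ≟ j ⌋ ≡ true → i ≡ j
  ⌊≟⌋-true⁻ {i} {j} _ with i ≟ j
  ... | yes i≡j = i≡j

  ⌊≟⌋-false : {i j : Fin n} → i ≢ j → ⌊ i ≟ j ⌋ ≡ false
  ⌊≟⌋-false {i} {j} i≢j with i ≟ j
  ... | yes i≡j = ⊥-elim (i≢j i≡j)
  ... | no _    = refl

-- `search G i j k f` is the least k′ with k ≤ k′ < k + f and `reachWithin G k′ i j`,
-- or k + f if there is none; `dist G i j` is `search G i j 0 n` by definition.
-- That search is a helper local to Defs which cannot be named here, so `search`
-- is a meta solved by unification against it (the `with`s turn its arguments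
-- into variables).
mutual
  search : ∀ {n} (G : SimpleGraph n) (i j : Fin n) → ℕ → ℕ → ℕ
  search G i j = _

  private
    search-solution : ∀ {m} (G : SimpleGraph (suc m)) i j → Σ ℕ (_≡ dist G i j)
    search-solution {m} G i j with suc m
    ... | n with m
    ... | f with 1
    ... | k = (if reachWithin G 0 i j then 0 else search {n} G i j k f) , refl

module Distance {n} (G : SimpleGraph n) where

  R : ℕ → Fin n → Fin n → Bool
  R = reachWithin G

  d : Fin n → Fin n → ℕ
  d = dist G

  adj-sym : ∀ {i j} → Adj G i j → Adj G j i
  adj-sym {i} {j} = trans (SimpleGraph.sym G j i)

  walk-snoc : ∀ {i j k l} → Walk G i j l → Adj G j k → Walk G i k (suc l)
  walk-snoc nil        a = cons a nil
  walk-snoc (cons b w) a = cons b (walk-snoc w a)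

  walk-reverse : ∀ {i j l} → Walk G i j l → Walk G j i l
  walk-reverse nil        = nil
  walk-reverse (cons a w) = walk-snoc (walk-reverse w) (adj-sym a)

  walk-++ : ∀ {i j k a b} → Walk G i j a → Walk G j k b → Walk G i k (a + b)
  walk-++ nil        w = w
  walk-++ (cons a v) w = cons a (walk-++ v w)

  reachWithin-sound : ∀ k i j → R k i j ≡ true → ∃ λ l → l ≤ k × Walk G i j l
  reachWithin-sound zero i j i≟j with ⌊≟⌋-true⁻ {i = i} {j} i≟j
  ... | refl = 0 , z≤n , nil
  reachWithin-sound (suc k) i j reach with ∨-true⁻ {R k i j} reach
  ... | inj₁ reach-k with reachWithin-sound k i j reach-k
  ...   | l , l≤k , w = l , m≤n⇒m≤1+n l≤k , w
  reachWithin-sound (suc k) i j reach | inj₂ step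
    with any-witness (λ l → adj G i l ∧ R k l j) (allFin n) step
  ... | l , step-l with ∧-true⁻ {adj G i l} step-l
  ... | a , reach-l with reachWithin-sound k l j reach-l
  ... | q , q≤k , w = suc q , s≤s q≤k , cons a w

  reachWithin-complete : ∀ {i j l} → Walk G i j l → ∀ k → l ≤ k → R k i j ≡ true
  reachWithin-complete {i} nil zero    _ = ⌊≟⌋-refl i
  reachWithin-complete {i} nil (suc k) _ rewrite reachWithin-complete {i} nil k z≤n = refl
  reachWithin-complete {i} {j} (cons {k = m} a w) (suc k) (s≤s l≤k) =
    ∨-trueʳ (R k i j) (any-intro (λ l → adj G i l ∧ R k l j) (∈-allFin m)
                                  (cong₂ _∧_ a (reachWithin-complete w k l≤k)))

  module _ (i j : Fin n) where

    search≤ : ∀ k f → search G i j k f ≤ k + f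
    search≤ k zero    = ≤-reflexive (sym (+-identityʳ k))
    search≤ k (suc f) with R k i j
    ... | true  = m≤m+n k (suc f)
    ... | false = ≤-trans (search≤ (suc k) f) (≤-reflexive (sym (+-suc k f)))

    search-least : ∀ k f t → k ≤ t → R t i j ≡ true → search G i j k f ≤ t
    search-least k zero    t k≤t _ = k≤t
    search-least k (suc f) t k≤t reach-t with R k i j in reach-k
    ... | true  = k≤t
    ... | false = search-least (suc k) f t (≤∧≢⇒< k≤t k≢t) reach-t
      where
      k≢t : k ≢ t
      k≢t refl with () ← trans (sym reach-k) reach-t

    search-hit : ∀ k f → search G i j k f < k + f → R (search G i j k f) i j ≡ true
    search-hit k zero    s<k = ⊥-elim (<-irrefl (sym (+-identityʳ k)) s<k)
    search-hit k (suc f) s<k+f with R k i j in reach-k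
    ... | true  = reach-k
    ... | false = search-hit (suc k) f (<-≤-trans s<k+f (≤-reflexive (+-suc k f)))

  dist-least : ∀ {i j} t → R t i j ≡ true → d i j ≤ t
  dist-least {i} {j} t = search-least i j 0 n t z≤n

  dist≤n : ∀ i j → d i j ≤ n
  dist≤n i j = search≤ i j 0 n

  dist≤walk : ∀ {i j l} → Walk G i j l → d i j ≤ l
  dist≤walk {l = l} w = dist-least l (reachWithin-complete w l ≤-refl)

  dist-adj : ∀ {i j} → Adj G i j → d i j ≤ 1
  dist-adj a = dist≤walk (cons a nil)

  dist-refl : ∀ i → d i i ≡ 0
  dist-refl i = n≤0⇒n≡0 (dist≤walk (nil {i = i}))

  shortest-walk : ∀ {i j} → d i j < n → Walk G i j (d i j)
  shortest-walk {i} {j} d<n with reachWithin-sound (d i j) i j (search-hit i j 0 n d<n)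
  ... | l , l≤d , w = subst (Walk G i j) (≤-antisym l≤d (dist≤walk w)) w

  -- `dist` returns the junk value n when no walk of length < n exists
  dist-junk⊎walk : ∀ i j → d i j ≡ n ⊎ Walk G i j (d i j)
  dist-junk⊎walk i j with m≤n⇒m<n∨m≡n (dist≤n i j)
  ... | inj₁ d<n = inj₂ (shortest-walk d<n)
  ... | inj₂ d≡n = inj₁ d≡n

  dist-sym-≤ : ∀ i j → d j i ≤ d i j
  dist-sym-≤ i j with dist-junk⊎walk i j
  ... | inj₁ d≡n = ≤-trans (dist≤n j i) (≤-reflexive (sym d≡n))
  ... | inj₂ w   = dist≤walk (walk-reverse w)

  dist-sym : ∀ i j → d i j ≡ d j i
  dist-sym i j = ≤-antisym (dist-sym-≤ j i) (dist-sym-≤ i j)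

  dist-triangle : ∀ i j k → d i k ≤ d i j + d j k
  dist-triangle i j k with dist-junk⊎walk i j | dist-junk⊎walk j k
  ... | inj₁ d≡n | _        = ≤-trans (dist≤n i k) (≤-trans (≤-reflexive (sym d≡n)) (m≤m+n _ _))
  ... | inj₂ _   | inj₁ d≡n = ≤-trans (dist≤n i k) (≤-trans (≤-reflexive (sym d≡n)) (m≤n+m _ _))
  ... | inj₂ v   | inj₂ w   = dist≤walk (walk-++ v w)

  dist≡0⇒≡ : ∀ {i j} → d i j ≡ 0 → i ≡ j
  dist≡0⇒≡ {i} {j} d≡0 with dist-junk⊎walk i j
  ... | inj₁ d≡n = ⊥-elim (n≮0 (subst (toℕ i <_) (trans (sym d≡n) d≡0) (Fin.toℕ<n i)))
  ... | inj₂ w   = walk₀⇒≡ (subst (Walk G i j) d≡0 w)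
    where
    walk₀⇒≡ : Walk G i j 0 → i ≡ j
    walk₀⇒≡ nil = refl

  dist-step : ∀ {j r k} → d j r ≡ suc k → suc k < n → ∃ λ l → Adj G j l × d l r ≡ k
  dist-step {j} {r} {k} d≡1+k 1+k<n
    with subst (Walk G j r) d≡1+k (shortest-walk (subst (_< n) (sym d≡1+k) 1+k<n))
  ... | cons {k = l} a w = l , a , ≤-antisym (dist≤walk w) k≤d
    where
    k≤d : k ≤ d l r
    k≤d = s≤s⁻¹ (begin
      suc k         ≡⟨ d≡1+k ⟨
      d j r         ≤⟨ dist-triangle j l r ⟩
      d j l + d l r ≤⟨ +-monoˡ-≤ (d l r) (dist-adj a) ⟩
      1 + d l r     ∎)
      where open ≤-Reasoning

Subset : ℕ → Set
Subset n = Fin n → Bool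

｛_｝ : ∀ {n} → Fin n → Subset n
｛ w ｝ u = ⌊ u ≟ w ⌋

_∪_ : ∀ {n} → Subset n → Subset n → Subset n
(U ∪ V) u = U u ∨ V u

∑∈ : ∀ {n} → Subset n → (Fin n → ℕ) → ℕ
∑∈ {n} U h = ∑[ u < n ] (𝟙 (U u) * h u)

∣_∣ : ∀ {n} → Subset n → ℕ
∣ U ∣ = ∑∈ U (λ _ → 1)

module _ {n : ℕ} where

  ∑∈-cong : ∀ (U : Subset n) {h g} → (∀ u → h u ≡ g u) → ∑∈ U h ≡ ∑∈ U g
  ∑∈-cong U h≡g = sum-cong-≗ λ u → cong (𝟙 (U u) *_) (h≡g u)

  ∑∈-mono-≤ : ∀ (U : Subset n) {h g} → (∀ u → h u ≤ g u) → ∑∈ U h ≤ ∑∈ U g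
  ∑∈-mono-≤ U h≤g = sum-mono-≤ λ u → *-monoʳ-≤ (𝟙 (U u)) (h≤g u)

  ∑∈-+ : ∀ (U : Subset n) h g → ∑∈ U (λ u → h u + g u) ≡ ∑∈ U h + ∑∈ U g
  ∑∈-+ U h g = trans (sum-cong-≗ λ u → *-distribˡ-+ (𝟙 (U u)) (h u) (g u))
                     (∑-distrib-+ (λ u → 𝟙 (U u) * h u) (λ u → 𝟙 (U u) * g u))

  ∑∈-full : ∀ (U : Subset n) → (∀ u → U u ≡ true) → ∀ h → ∑∈ U h ≡ sum h
  ∑∈-full U full h = sum-cong-≗ λ u → trans (cong (λ b → 𝟙 b * h u) (full u)) (+-identityʳ (h u))

  ∑∈-｛｝ : ∀ (w : Fin n) h → ∑∈ ｛ w ｝ h ≡ h w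
  ∑∈-｛｝ w h = trans (sum-single (λ u → 𝟙 (｛ w ｝ u) * h u) w λ u u≢w → cong (λ b → 𝟙 b * h u) (⌊≟⌋-false u≢w))
                      (trans (cong (λ b → 𝟙 b * h w) (⌊≟⌋-refl w)) (+-identityʳ (h w)))

  ∑∈-∪｛｝ : ∀ (U : Subset n) {w} → U w ≡ false → ∀ h → ∑∈ (U ∪ ｛ w ｝) h ≡ ∑∈ U h + h w
  ∑∈-∪｛｝ U {w} w∉U h = begin
    ∑∈ (U ∪ ｛ w ｝) h                                ≡⟨ sum-cong-≗ (λ u → cong (_* h u) (𝟙-∪ u)) ⟩
    ∑[ u < n ] ((𝟙 (U u) + 𝟙 (｛ w ｝ u)) * h u)       ≡⟨ sum-cong-≗ (λ u → *-distribʳ-+ (h u) (𝟙 (U u)) (𝟙 (｛ w ｝ u))) ⟩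
    ∑[ u < n ] (𝟙 (U u) * h u + 𝟙 (｛ w ｝ u) * h u)   ≡⟨ ∑-distrib-+ (λ u → 𝟙 (U u) * h u) (λ u → 𝟙 (｛ w ｝ u) * h u) ⟩
    ∑∈ U h + ∑∈ ｛ w ｝ h                            ≡⟨ cong (∑∈ U h +_) (∑∈-｛｝ w h) ⟩
    ∑∈ U h + h w                                    ∎
    where
    open ≡-Reasoning
    𝟙-∪ : ∀ u → 𝟙 ((U ∪ ｛ w ｝) u) ≡ 𝟙 (U u) + 𝟙 (｛ w ｝ u)
    𝟙-∪ u with U u in u∈U
    ... | false = refl
    ... | true  = cong (λ b → 1 + 𝟙 b) (sym (⌊≟⌋-false u≢w))
      where
      u≢w : u ≢ w
      u≢w refl with () ← trans (sym w∉U) u∈U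

  ∈-∪｛｝⁻ : ∀ (U : Subset n) {w u} → (U ∪ ｛ w ｝) u ≡ true → U u ≡ true ⊎ u ≡ w
  ∈-∪｛｝⁻ U {w} {u} u∈ with ∨-true⁻ {U u} u∈
  ... | inj₁ u∈U = inj₁ u∈U
  ... | inj₂ u≟w = inj₂ (⌊≟⌋-true⁻ u≟w)

  ∣∣≡n⇒full : ∀ (U : Subset n) → ∣ U ∣ ≡ n → ∀ u → U u ≡ true
  ∣∣≡n⇒full U ∣U∣≡n u with U u in u∈U
  ... | true  = refl
  ... | false = ⊥-elim (<-irrefl ∣U∣≡n (sum<n 𝟙*1≤1 u (cong (λ b → 𝟙 b * 1) u∈U)))
    where
    𝟙*1≤1 : ∀ v → 𝟙 (U v) * 1 ≤ 1
    𝟙*1≤1 v = ≤-trans (≤-reflexive (*-identityʳ _)) (𝟙≤1 (U v))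

∃-outside : ∀ {n} (U : Subset n) → ∣ U ∣ < n → ∃ λ u → U u ≡ false
∃-outside {suc n} U ∣U∣<n with U zero in U0
... | false = zero , U0
... | true  with ∃-outside (U ∘ suc) (s≤s⁻¹ ∣U∣<n)
...   | u , Uu = suc u , Uu

wienerIndex : ∀ {n} → SimpleGraph n → ℕ
wienerIndex {n} G = ∑[ u < n ] ∑[ v < n ] dist G u v

walk-exit : ∀ {n} {G : SimpleGraph n} (U : Subset n) {x y l} → Walk G x y l →
            U x ≡ true → U y ≡ false → ∃₂ λ p w → U p ≡ true × U w ≡ false × Adj G p w
walk-exit U nil Ux Uy with () ← trans (sym Ux) Uy
walk-exit U {x} (cons {k = k} a w) Ux Uy with U k in Uk
... | true  = walk-exit U w Uk Uy
... | false = x , k , Ux , Uk , a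

module WienerBound {M : ℕ} (G : SimpleGraph (suc M)) (conn : Connected G) where
  open Distance G

  N : ℕ
  N = suc M

  distSum : Subset N → Fin N → ℕ
  distSum U v = ∑∈ U (d v)

  wiener : Subset N → ℕ
  wiener U = ∑∈ U (distSum U)

  -- the bounds are those attained by a path on m + 1 vertices
  record PathBounded (U : Subset N) (m : ℕ) : Set where
    field
      root∈    : U zero ≡ true
      size     : ∣ U ∣ ≡ suc m
      diameter : ∀ {u v} → U u ≡ true → U v ≡ true → d u v ≤ m
      distSum≤ : ∀ {v} → U v ≡ true → 2 * distSum U v ≤ suc m * m
      wiener≤  : 3 * wiener U ≤ m * suc m * suc (suc m)

  singleton-pathBounded : PathBounded ｛ zero ｝ 0
  singleton-pathBounded = record
    { root∈    = refl
    ; size     = ∑∈-｛｝ {N} zero (λ _ → 1)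
    ; diameter = λ u∈ v∈ → ≤-reflexive (dist-at-root (⌊≟⌋-true⁻ u∈) (⌊≟⌋-true⁻ v∈))
    ; distSum≤ = λ v∈ → ≤-reflexive (cong (2 *_) (distSum-root (⌊≟⌋-true⁻ v∈)))
    ; wiener≤  = ≤-reflexive (cong (3 *_) (trans (∑∈-｛｝ {N} zero (distSum ｛ zero ｝)) (distSum-root refl)))
    }
    where
    dist-at-root : ∀ {u v} → u ≡ zero → v ≡ zero → d u v ≡ 0
    dist-at-root refl refl = dist-refl zero
    distSum-root : ∀ {v} → v ≡ zero → distSum ｛ zero ｝ v ≡ 0
    distSum-root refl = trans (∑∈-｛｝ {N} zero (d zero)) (dist-refl zero)

  module Extend {U m} (U-bounded : PathBounded U m) {p w}
                (p∈U : U p ≡ true) (w∉U : U w ≡ false) (a : Adj G p w) where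
    open PathBounded U-bounded

    U′ : Subset N
    U′ = U ∪ ｛ w ｝

    distSum-∪ : ∀ v → distSum U′ v ≡ distSum U v + d v w
    distSum-∪ v = ∑∈-∪｛｝ U w∉U (d v)

    distSum-new : distSum U′ w ≡ distSum U w
    distSum-new = trans (distSum-∪ w) (trans (cong (distSum U w +_) (dist-refl w)) (+-identityʳ _))

    wiener-∪ : wiener U′ ≡ wiener U + (distSum U w + distSum U w)
    wiener-∪ = begin
      wiener U′                                          ≡⟨ ∑∈-∪｛｝ U w∉U (distSum U′) ⟩
      ∑∈ U (distSum U′) + distSum U′ w                   ≡⟨ cong₂ _+_ (∑∈-cong U λ u → distSum-∪ u) distSum-new ⟩
      ∑∈ U (λ u → distSum U u + d u w) + distSum U w     ≡⟨ cong (_+ distSum U w) (∑∈-+ U (distSum U) (λ u → d u w)) ⟩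
      wiener U + ∑∈ U (λ u → d u w) + distSum U w        ≡⟨ cong (λ s → wiener U + s + distSum U w) (∑∈-cong U λ u → dist-sym u w) ⟩
      wiener U + distSum U w + distSum U w               ≡⟨ +-assoc (wiener U) _ _ ⟩
      wiener U + (distSum U w + distSum U w)             ∎
      where open ≡-Reasoning

    -- every vertex of U is at most one step further from w than from p
    distSum-new≤ : 2 * distSum U w ≤ 2 * suc m + suc m * m
    distSum-new≤ = begin
      2 * distSum U w                   ≤⟨ *-monoʳ-≤ 2 (∑∈-mono-≤ U λ u → ≤-trans (dist-triangle w p u)
                                                          (+-monoˡ-≤ (d p u) (dist-adj (adj-sym a)))) ⟩
      2 * ∑∈ U (λ u → 1 + d p u)        ≡⟨ cong (2 *_) (∑∈-+ U (λ _ → 1) (d p)) ⟩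
      2 * (∣ U ∣ + distSum U p)         ≡⟨ *-distribˡ-+ 2 ∣ U ∣ (distSum U p) ⟩
      2 * ∣ U ∣ + 2 * distSum U p       ≤⟨ +-mono-≤ (≤-reflexive (cong (2 *_) size)) (distSum≤ p∈U) ⟩
      2 * suc m + suc m * m             ∎
      where open ≤-Reasoning

    dist-to-new≤ : ∀ {u} → U u ≡ true → d u w ≤ suc m
    dist-to-new≤ {u} u∈U = ≤-trans (dist-triangle u p w)
      (≤-trans (+-mono-≤ (diameter u∈U p∈U) (dist-adj a)) (≤-reflexive (+-comm m 1)))

    diameter-∪ : ∀ {u v} → U′ u ≡ true → U′ v ≡ true → d u v ≤ suc m
    diameter-∪ {u} {v} u∈ v∈ with ∈-∪｛｝⁻ U u∈ | ∈-∪｛｝⁻ U v∈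
    ... | inj₁ u∈U  | inj₁ v∈U  = m≤n⇒m≤1+n (diameter u∈U v∈U)
    ... | inj₁ u∈U  | inj₂ refl = dist-to-new≤ u∈U
    ... | inj₂ refl | inj₁ v∈U  = ≤-trans (≤-reflexive (dist-sym w v)) (dist-to-new≤ v∈U)
    ... | inj₂ refl | inj₂ refl = subst (_≤ suc m) (sym (dist-refl w)) z≤n

    distSum-step : suc m * m + 2 * suc m ≡ suc (suc m) * suc m
    distSum-step = solve m
      where
      solve : ∀ m → suc m * m + 2 * suc m ≡ suc (suc m) * suc m
      solve = solve-∀

    distSum≤-∪ : ∀ {v} → U′ v ≡ true → 2 * distSum U′ v ≤ suc (suc m) * suc m
    distSum≤-∪ {v} v∈ with ∈-∪｛｝⁻ U v∈
    ... | inj₁ v∈U = begin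
      2 * distSum U′ v                 ≡⟨ cong (2 *_) (distSum-∪ v) ⟩
      2 * (distSum U v + d v w)        ≡⟨ *-distribˡ-+ 2 (distSum U v) (d v w) ⟩
      2 * distSum U v + 2 * d v w      ≤⟨ +-mono-≤ (distSum≤ v∈U) (*-monoʳ-≤ 2 (dist-to-new≤ v∈U)) ⟩
      suc m * m + 2 * suc m            ≡⟨ distSum-step ⟩
      suc (suc m) * suc m              ∎
      where open ≤-Reasoning
    ... | inj₂ refl = begin
      2 * distSum U′ w                 ≡⟨ cong (2 *_) distSum-new ⟩
      2 * distSum U w                  ≤⟨ distSum-new≤ ⟩
      2 * suc m + suc m * m            ≡⟨ +-comm (2 * suc m) _ ⟩
      suc m * m + 2 * suc m            ≡⟨ distSum-step ⟩
      suc (suc m) * suc m              ∎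
      where open ≤-Reasoning

    wiener≤-∪ : 3 * wiener U′ ≤ suc m * suc (suc m) * suc (suc (suc m))
    wiener≤-∪ = begin
      3 * wiener U′                                         ≡⟨ cong (3 *_) wiener-∪ ⟩
      3 * (wiener U + (distSum U w + distSum U w))          ≡⟨ *-distribˡ-+ 3 (wiener U) _ ⟩
      3 * wiener U + 3 * (distSum U w + distSum U w)        ≡⟨ cong (λ s → 3 * wiener U + 3 * (distSum U w + s))
                                                                    (sym (+-identityʳ _)) ⟩
      3 * wiener U + 3 * (2 * distSum U w)                  ≤⟨ +-mono-≤ wiener≤ (*-monoʳ-≤ 3 distSum-new≤) ⟩
      m * suc m * suc (suc m) + 3 * (2 * suc m + suc m * m) ≡⟨ solve m ⟩
      suc m * suc (suc m) * suc (suc (suc m))               ∎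
      where
      open ≤-Reasoning
      solve : ∀ m → m * suc m * suc (suc m) + 3 * (2 * suc m + suc m * m)
                    ≡ suc m * suc (suc m) * suc (suc (suc m))
      solve = solve-∀

    extended : PathBounded U′ (suc m)
    extended = record
      { root∈    = cong (_∨ ｛ w ｝ zero) root∈
      ; size     = trans (∑∈-∪｛｝ U w∉U (λ _ → 1)) (trans (cong (_+ 1) size) (+-comm (suc m) 1))
      ; diameter = diameter-∪
      ; distSum≤ = distSum≤-∪
      ; wiener≤  = wiener≤-∪
      }

  grow : ∀ m → m < N → Σ (Subset N) λ U → PathBounded U m
  grow zero    _     = ｛ zero ｝ , singleton-pathBounded
  grow (suc m) m<N with grow m (<-trans (n<1+n m) m<N)
  ... | U , U-bounded with ∃-outside U (subst (_< N) (sym (PathBounded.size U-bounded)) m<N)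
  ... | u , u∉U with walk-exit U (proj₂ (conn zero u)) (PathBounded.root∈ U-bounded) u∉U
  ... | p , w , p∈U , w∉U , a = U ∪ ｛ w ｝ , Extend.extended U-bounded p∈U w∉U a

  private
    spanning : Σ (Subset N) λ U → PathBounded U M
    spanning = grow M ≤-refl

    spanning-full : ∀ u → proj₁ spanning u ≡ true
    spanning-full = ∣∣≡n⇒full (proj₁ spanning) (PathBounded.size (proj₂ spanning))

  diameter≤ : ∀ u v → d u v ≤ M
  diameter≤ u v = PathBounded.diameter (proj₂ spanning) (spanning-full u) (spanning-full v)

  wienerIndex≤ : 3 * wienerIndex G ≤ M * suc M * suc (suc M)
  wienerIndex≤ = ≤-trans (≤-reflexive (cong (3 *_) (sym wiener-spanning))) (PathBounded.wiener≤ (proj₂ spanning))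
    where
    wiener-spanning : wiener (proj₁ spanning) ≡ wienerIndex G
    wiener-spanning = trans (∑∈-full _ spanning-full (distSum (proj₁ spanning)))
                            (sum-cong-≗ λ u → ∑∈-full _ spanning-full (d u))

deg≡∑adj : ∀ {n} (G : SimpleGraph n) j → deg G j ≡ ∑[ k < n ] 𝟙 (adj G j k)
deg≡∑adj G j = sum-map-allFin (𝟙 ∘ adj G j)

level-trichotomy : ∀ a b → a ≤ suc b → b ≤ suc a →
                   𝟙 (suc b ≡ᵇ a) + 𝟙 (suc a ≡ᵇ b) + 𝟙 (a ≡ᵇ b) ≡ 1
level-trichotomy zero          zero          _ _ = refl
level-trichotomy zero          (suc zero)    _ _ = refl
level-trichotomy (suc zero)    zero          _ _ = refl
level-trichotomy (suc a)       (suc b)       a≤1+b b≤1+a = level-trichotomy a b (s≤s⁻¹ a≤1+b) (s≤s⁻¹ b≤1+a)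
level-trichotomy zero          (suc (suc b)) _ (s≤s ())
level-trichotomy (suc (suc a)) zero          (s≤s ()) _

double-split : ∀ l → 𝟙 (0 <ᵇ l) * (l + (l ∸ 1)) + 𝟙 (0 <ᵇ l) ≡ 2 * l
double-split zero    = refl
double-split (suc l) = arith l
  where
  arith : ∀ l → 1 * (suc l + l) + 1 ≡ 2 * suc l
  arith = solve-∀

module Levels {M : ℕ} (G : SimpleGraph (suc M)) (conn : Connected G) (r : Fin (suc M)) where
  open Distance G
  open WienerBound G conn using (N; diameter≤)

  level : Fin N → ℕ
  level x = d x r

  parent-exists : ∀ {x k} → level x ≡ suc k → ∃ λ l → Adj G x l × level l ≡ k
  parent-exists {x} e = dist-step e (subst (_< N) e (s≤s (diameter≤ x r)))

  parentEdge levelEdge : Fin N → Fin N → ℕ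
  parentEdge j k = 𝟙 (adj G j k ∧ (suc (level k) ≡ᵇ level j))
  levelEdge  j k = 𝟙 (adj G j k ∧ (level j ≡ᵇ level k))

  parents : Fin N → ℕ
  parents j = ∑[ k < N ] parentEdge j k

  nonRoot : Fin N → ℕ
  nonRoot j = 𝟙 (0 <ᵇ level j)

  edge-trichotomy : ∀ j k → 𝟙 (adj G j k) ≡ parentEdge j k + parentEdge k j + levelEdge j k
  edge-trichotomy j k rewrite SimpleGraph.sym G k j with adj G j k in a
  ... | false = refl
  ... | true  = sym (level-trichotomy (level j) (level k)
      (≤-trans (dist-triangle j k r) (+-monoˡ-≤ (level k) (dist-adj a)))
      (≤-trans (dist-triangle k j r) (+-monoˡ-≤ (level j) (dist-adj (adj-sym a)))))

  parentEdge-level : ∀ k j (h : ℕ → ℕ) → parentEdge k j * h (level j) ≡ parentEdge k j * h (level k ∸ 1)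
  parentEdge-level k j h with suc (level j) ≡ᵇ level k in e
  ... | true  = cong (λ l → 𝟙 (adj G k j ∧ true) * h (l ∸ 1)) (≡ᵇ-true⁻ {suc (level j)} {level k} e)
  ... | false rewrite ∧-zeroʳ (adj G k j) = refl

  -- Σ_j deg j · h(level j) counts each edge at both ends. An edge either lies within a
  -- level or is a parent edge j k with level k = level j − 1; the latter is charged to j.
  level-decomposition : ∀ (h : ℕ → ℕ) →
    ∑[ j < N ] (deg G j * h (level j)) ≡
    ∑[ j < N ] (parents j * (h (level j) + h (level j ∸ 1))) + ∑[ j < N ] ∑[ k < N ] (levelEdge j k * h (level j))
  level-decomposition h = begin
    ∑[ j < N ] (deg G j * H j)
      ≡⟨ sum-cong-≗ (λ j → trans (cong (_* H j) (deg≡∑adj G j)) (*-distribʳ-sum (H j) (𝟙 ∘ adj G j))) ⟩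
    ∑[ j < N ] ∑[ k < N ] (𝟙 (adj G j k) * H j)
      ≡⟨ sum-cong-≗ (λ j → sum-cong-≗ λ k → trans (cong (_* H j) (edge-trichotomy j k))
                                                  (split (parentEdge j k) (parentEdge k j) (levelEdge j k) (H j))) ⟩
    ∑[ j < N ] ∑[ k < N ] (parentEdge j k * H j + parentEdge k j * H j + levelEdge j k * H j)
      ≡⟨ trans (∑∑-distrib-+ (λ j k → parentEdge j k * H j + parentEdge k j * H j) (λ j k → levelEdge j k * H j))
               (cong (_+ L) (∑∑-distrib-+ (λ j k → parentEdge j k * H j) (λ j k → parentEdge k j * H j))) ⟩
    ∑[ j < N ] ∑[ k < N ] (parentEdge j k * H j) + ∑[ j < N ] ∑[ k < N ] (parentEdge k j * H j) + L
      ≡⟨ cong (_+ L) (cong₂ _+_ down up) ⟩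
    ∑[ j < N ] (parents j * H j) + ∑[ j < N ] (parents j * H′ j) + L
      ≡⟨ cong (_+ L) (trans (sym (∑-distrib-+ (λ j → parents j * H j) (λ j → parents j * H′ j)))
                            (sum-cong-≗ λ j → sym (*-distribˡ-+ (parents j) (H j) (H′ j)))) ⟩
    ∑[ j < N ] (parents j * (H j + H′ j)) + L ∎
    where
    open ≡-Reasoning
    H H′ : Fin N → ℕ
    H  j = h (level j)
    H′ j = h (level j ∸ 1)
    L : ℕ
    L = ∑[ j < N ] ∑[ k < N ] (levelEdge j k * H j)
    split : ∀ a b c x → (a + b + c) * x ≡ a * x + b * x + c * x
    split = solve-∀
    down : ∑[ j < N ] ∑[ k < N ] (parentEdge j k * H j) ≡ ∑[ j < N ] (parents j * H j)
    down = sum-cong-≗ λ j → sym (*-distribʳ-sum (H j) (parentEdge j))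
    up : ∑[ j < N ] ∑[ k < N ] (parentEdge k j * H j) ≡ ∑[ j < N ] (parents j * H′ j)
    up = trans (sum-cong-≗ λ j → sum-cong-≗ λ k → parentEdge-level k j h)
        (trans (∑-comm (λ j k → parentEdge k j * H′ k)) (sum-cong-≗ λ k → sym (*-distribʳ-sum (H′ k) (parentEdge k))))

  parentEdge-to : ∀ {j l k} → Adj G j l → level l ≡ k → level j ≡ suc k → parentEdge j l ≡ 1
  parentEdge-to {l = l} {k} a l≡k j≡1+k =
    cong₂ (λ b c → 𝟙 (b ∧ c)) a (trans (cong₂ _≡ᵇ_ (cong suc l≡k) j≡1+k) (≡ᵇ-refl (suc k)))

  nonRoot≤parents : ∀ j → nonRoot j ≤ parents j
  nonRoot≤parents j = by-level (level j) refl
    where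
    by-level : ∀ l → level j ≡ l → nonRoot j ≤ parents j
    by-level zero    lj = subst (λ l → 𝟙 (0 <ᵇ l) ≤ parents j) (sym lj) z≤n
    by-level (suc k) lj with parent-exists lj
    ... | l , a , l≡k = ≤-trans (𝟙≤1 _) (≤-trans (≤-reflexive (sym (parentEdge-to a l≡k lj))) (term≤sum (parentEdge j) l))

  ∑-nonRoot : ∑[ j < N ] nonRoot j ≡ M
  ∑-nonRoot = +-cancelʳ-≡ 1 _ M (begin
    ∑[ j < N ] nonRoot j + 1                          ≡⟨ cong (∑[ j < N ] nonRoot j +_) (sym (∑∈-｛｝ r (λ _ → 1))) ⟩
    ∑[ j < N ] nonRoot j + ∑∈ ｛ r ｝ (λ _ → 1)         ≡⟨ sym (∑-distrib-+ nonRoot (λ j → 𝟙 (｛ r ｝ j) * 1)) ⟩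
    ∑[ j < N ] (nonRoot j + 𝟙 (｛ r ｝ j) * 1)          ≡⟨ sum-cong-≗ nonRoot-or-root ⟩
    ∑[ j < N ] 1                                      ≡⟨ trans (sum-const N 1) (trans (*-identityʳ N) (+-comm 1 M)) ⟩
    M + 1                                             ∎)
    where
    open ≡-Reasoning
    nonRoot-or-root : ∀ j → nonRoot j + 𝟙 (｛ r ｝ j) * 1 ≡ 1
    nonRoot-or-root j with level j in lj
    ... | zero rewrite dist≡0⇒≡ lj | ⌊≟⌋-refl r = refl
    ... | suc _ = cong (λ b → 1 + 𝟙 b * 1) (⌊≟⌋-false j≢r)
      where
      j≢r : j ≢ r
      j≢r refl with () ← trans (sym lj) (dist-refl r)

  nonRoot-levelSum : ∑[ j < N ] (nonRoot j * (level j + (level j ∸ 1))) + M ≡ 2 * ∑[ j < N ] level j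
  nonRoot-levelSum = begin
    ∑[ j < N ] (nonRoot j * (level j + (level j ∸ 1))) + M
      ≡⟨ cong (∑[ j < N ] (nonRoot j * (level j + (level j ∸ 1))) +_) (sym ∑-nonRoot) ⟩
    ∑[ j < N ] (nonRoot j * (level j + (level j ∸ 1))) + ∑[ j < N ] nonRoot j
      ≡⟨ sym (∑-distrib-+ (λ j → nonRoot j * (level j + (level j ∸ 1))) nonRoot) ⟩
    ∑[ j < N ] (nonRoot j * (level j + (level j ∸ 1)) + nonRoot j)
      ≡⟨ sum-cong-≗ (λ j → double-split (level j)) ⟩
    ∑[ j < N ] (2 * level j)
      ≡⟨ sym (*-distribˡ-sum 2 level) ⟩
    2 * ∑[ j < N ] level j ∎
    where open ≡-Reasoning

  degLevelSum-lower : 2 * ∑[ j < N ] level j ≤ ∑[ j < N ] (deg G j * level j) + M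
  degLevelSum-lower = begin
    2 * ∑[ j < N ] level j
      ≡⟨ sym nonRoot-levelSum ⟩
    ∑[ j < N ] (nonRoot j * (level j + (level j ∸ 1))) + M
      ≤⟨ +-monoˡ-≤ M (sum-mono-≤ λ j → *-monoˡ-≤ (level j + (level j ∸ 1)) (nonRoot≤parents j)) ⟩
    ∑[ j < N ] (parents j * (level j + (level j ∸ 1))) + M
      ≤⟨ +-monoˡ-≤ M (m≤m+n _ _) ⟩
    ∑[ j < N ] (parents j * (level j + (level j ∸ 1))) + ∑[ j < N ] ∑[ k < N ] (levelEdge j k * level j) + M
      ≡⟨ cong (_+ M) (sym (level-decomposition (λ l → l))) ⟩
    ∑[ j < N ] (deg G j * level j) + M ∎
    where open ≤-Reasoning

chain-snoc : ∀ {n} {G : SimpleGraph n} a xs b {c} →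
             Chain G (a ∷ xs ++ [ b ]) → Adj G b c → Chain G ((a ∷ xs ++ [ b ]) ++ [ c ])
chain-snoc a []       b (ab , _)  bc = ab , bc , tt
chain-snoc a (x ∷ xs) b (ax , ch) bc = ax , chain-snoc x xs b ch bc

1≤length-∷ʳ : ∀ {A : Set} (xs : List A) y → 1 ≤ length (xs ++ [ y ])
1≤length-∷ʳ []      _ = s≤s z≤n
1≤length-∷ʳ (_ ∷ _) _ = s≤s z≤n

module Trees {M : ℕ} (G : SimpleGraph (suc M)) (conn : Connected G) (acyclic : Acyclic G) (r : Fin (suc M)) where
  open Distance G
  open Levels G conn r

  N : ℕ
  N = suc M

  -- closed up by an edge x y, or through a common neighbour above level k, it is a cycle
  record LowPath (k : ℕ) (x y : Fin N) : Set where
    field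
      interior : List (Fin N)
      nonempty : 1 ≤ length interior
      unique   : Unique (x ∷ interior ++ [ y ])
      chain    : Chain G (x ∷ interior ++ [ y ])
      low      : All (λ v → level v ≤ k) (x ∷ interior ++ [ y ])

  above : ∀ {x v k} → level x ≡ suc k → level v ≤ k → x ≢ v
  above x≡1+k v≤k refl = 1+n≰n (≤-trans (≤-reflexive (sym x≡1+k)) v≤k)

  -- climb from both vertices to their parents until the two climbs meet
  lowPath : ∀ k {x y} → x ≢ y → level x ≡ k → level y ≡ k → LowPath k x y
  lowPath zero x≢y x≡0 y≡0 = ⊥-elim (x≢y (trans (dist≡0⇒≡ x≡0) (sym (dist≡0⇒≡ y≡0))))
  lowPath (suc k) {x} {y} x≢y x≡1+k y≡1+k with parent-exists x≡1+k | parent-exists y≡1+k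
  ... | px , x~px , px≡k | py , y~py , py≡k with px ≟ py
  ... | yes refl = record
    { interior = [ px ]
    ; nonempty = s≤s z≤n
    ; unique   = (above x≡1+k (≤-reflexive px≡k) ∷ x≢y ∷ []) ∷ ((above y≡1+k (≤-reflexive px≡k) ∘ sym) ∷ []) ∷ [] ∷ []
    ; chain    = x~px , adj-sym y~py , tt
    ; low      = ≤-reflexive x≡1+k ∷ m≤n⇒m≤1+n (≤-reflexive px≡k) ∷ ≤-reflexive y≡1+k ∷ []
    }
  ... | no px≢py = record
    { interior = px ∷ P.interior ++ [ py ]
    ; nonempty = s≤s z≤n
    ; unique   = All.++⁺ (All.map (above x≡1+k) P.low) (x≢y ∷ [])
                 ∷ AllPairs.++⁺ P.unique ([] ∷ []) (All.map (λ v≤k → (above y≡1+k v≤k ∘ sym) ∷ []) P.low)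
    ; chain    = x~px , chain-snoc px P.interior py P.chain (adj-sym y~py)
    ; low      = ≤-reflexive x≡1+k ∷ All.++⁺ (All.map m≤n⇒m≤1+n P.low) (≤-reflexive y≡1+k ∷ [])
    }
    where
    module P = LowPath (lowPath k px≢py px≡k py≡k)

  no-level-edge : ∀ {x y} → Adj G x y → level x ≢ level y
  no-level-edge {x} {y} x~y x≡y =
    acyclic (x , P.interior ++ [ y ] , two≤ P.interior P.nonempty , P.unique ,
             chain-snoc x P.interior y P.chain (adj-sym x~y))
    where
    x≢y : x ≢ y
    x≢y refl with () ← trans (sym (SimpleGraph.irrefl G x)) x~y
    module P = LowPath (lowPath (level x) x≢y refl (sym x≡y))
    two≤ : ∀ zs → 1 ≤ length zs → 2 ≤ length (zs ++ [ y ])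
    two≤ (z ∷ zs) _ = s≤s (1≤length-∷ʳ zs y)

  unique-parent : ∀ {j p q k} → Adj G j p → Adj G j q → level p ≡ k → level q ≡ k → level j ≡ suc k → p ≡ q
  unique-parent {j} {p} {q} {k} j~p j~q p≡k q≡k j≡1+k with p ≟ q
  ... | yes p≡q = p≡q
  ... | no p≢q  = ⊥-elim (acyclic (j , p ∷ P.interior ++ [ q ] , s≤s (1≤length-∷ʳ P.interior q) ,
                                   All.map (above j≡1+k) P.low ∷ P.unique ,
                                   j~p , chain-snoc p P.interior q P.chain (adj-sym j~q)))
    where
    module P = LowPath (lowPath k p≢q p≡k q≡k)

  levelEdge≡0 : ∀ j k → levelEdge j k ≡ 0
  levelEdge≡0 j k with adj G j k ∧ (level j ≡ᵇ level k) in e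
  ... | false = refl
  ... | true with ∧-true⁻ {adj G j k} e
  ...   | j~k , same = ⊥-elim (no-level-edge j~k (≡ᵇ-true⁻ {level j} {level k} same))

  parentEdge-cases : ∀ j i → parentEdge j i ≡ 0 ⊎ (Adj G j i × suc (level i) ≡ level j)
  parentEdge-cases j i with adj G j i ∧ (suc (level i) ≡ᵇ level j) in e
  ... | false = inj₁ refl
  ... | true with ∧-true⁻ {adj G j i} e
  ...   | j~i , one-up = inj₂ (j~i , ≡ᵇ-true⁻ {suc (level i)} {level j} one-up)

  parents≡nonRoot : ∀ j → parents j ≡ nonRoot j
  parents≡nonRoot j = by-level (level j) refl
    where
    nonRoot≡ : ∀ {l} → level j ≡ l → nonRoot j ≡ 𝟙 (0 <ᵇ l)
    nonRoot≡ = cong (λ l → 𝟙 (0 <ᵇ l))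
    by-level : ∀ l → level j ≡ l → parents j ≡ nonRoot j
    by-level zero lj = trans (sum-zero no-parent) (sym (nonRoot≡ lj))
      where
      no-parent : ∀ i → parentEdge j i ≡ 0
      no-parent i with parentEdge-cases j i
      ... | inj₁ none       = none
      ... | inj₂ (_ , i→j) with () ← trans i→j lj
    by-level (suc k) lj with parent-exists lj
    ... | l , j~l , l≡k = trans (sum-single (parentEdge j) l other-parent)
                                (trans (parentEdge-to j~l l≡k lj) (sym (nonRoot≡ lj)))
      where
      other-parent : ∀ i → i ≢ l → parentEdge j i ≡ 0
      other-parent i i≢l with parentEdge-cases j i
      ... | inj₁ none         = none
      ... | inj₂ (j~i , i→j) = ⊥-elim (i≢l (unique-parent j~i j~l (suc-injective (trans i→j lj)) l≡k lj))

  tree-decomposition : ∀ (h : ℕ → ℕ) →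
    ∑[ j < N ] (deg G j * h (level j)) ≡ ∑[ j < N ] (nonRoot j * (h (level j) + h (level j ∸ 1)))
  tree-decomposition h = begin
    ∑[ j < N ] (deg G j * h (level j))
      ≡⟨ level-decomposition h ⟩
    ∑[ j < N ] (parents j * (h (level j) + h (level j ∸ 1))) + ∑[ j < N ] ∑[ k < N ] (levelEdge j k * h (level j))
      ≡⟨ cong₂ _+_ (sum-cong-≗ λ j → cong (_* (h (level j) + h (level j ∸ 1))) (parents≡nonRoot j))
                   (sum-zero λ j → sum-zero λ k → cong (_* h (level j)) (levelEdge≡0 j k)) ⟩
    ∑[ j < N ] (nonRoot j * (h (level j) + h (level j ∸ 1))) + 0
      ≡⟨ +-identityʳ _ ⟩
    ∑[ j < N ] (nonRoot j * (h (level j) + h (level j ∸ 1))) ∎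
    where open ≡-Reasoning

  degLevelSum-tree : ∑[ j < N ] (deg G j * level j) + M ≡ 2 * ∑[ j < N ] level j
  degLevelSum-tree = trans (cong (_+ M) (tree-decomposition (λ l → l))) nonRoot-levelSum

  degSum-tree : ∑[ j < N ] deg G j ≡ 2 * M
  degSum-tree = begin
    ∑[ j < N ] deg G j               ≡⟨ sum-cong-≗ (λ j → sym (*-identityʳ (deg G j))) ⟩
    ∑[ j < N ] (deg G j * 1)         ≡⟨ tree-decomposition (λ _ → 1) ⟩
    ∑[ j < N ] (nonRoot j * 2)       ≡⟨ sym (*-distribʳ-sum 2 nonRoot) ⟩
    (∑[ j < N ] nonRoot j) * 2       ≡⟨ cong (_* 2) ∑-nonRoot ⟩
    M * 2                            ≡⟨ *-comm M 2 ⟩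
    2 * M                            ∎
    where open ≡-Reasoning

𝟙-split-< : ∀ a b x → (a ≡ b → x ≡ false) → 𝟙 x ≡ 𝟙 ((a <ᵇ b) ∧ x) + 𝟙 ((b <ᵇ a) ∧ x)
𝟙-split-< zero    zero    x a≡b⇒¬x rewrite a≡b⇒¬x refl = refl
𝟙-split-< zero    (suc b) x _      = sym (+-identityʳ (𝟙 x))
𝟙-split-< (suc a) zero    x _      = refl
𝟙-split-< (suc a) (suc b) x a≡b⇒¬x = 𝟙-split-< a b x (a≡b⇒¬x ∘ cong suc)

handshake : ∀ {n} (G : SimpleGraph n) → ∑[ i < n ] deg G i ≡ 2 * edges G
handshake {n} G = begin
  ∑[ i < n ] deg G i
    ≡⟨ sum-cong-≗ (deg≡∑adj G) ⟩
  ∑[ i < n ] ∑[ j < n ] 𝟙 (adj G i j)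
    ≡⟨ sum-cong-≗ (λ i → sum-cong-≗ λ j →
         trans (𝟙-split-< (toℕ i) (toℕ j) (adj G i j) (loopless i j))
               (cong (λ b → up i j + 𝟙 ((toℕ j <ᵇ toℕ i) ∧ b)) (SimpleGraph.sym G i j))) ⟩
  ∑[ i < n ] ∑[ j < n ] (up i j + up j i)
    ≡⟨ ∑∑-distrib-+ up (λ i j → up j i) ⟩
  E + ∑[ i < n ] ∑[ j < n ] up j i
    ≡⟨ cong (E +_) (∑-comm (λ i j → up j i)) ⟩
  E + E
    ≡⟨ cong (E +_) (sym (+-identityʳ E)) ⟩
  2 * E
    ≡⟨ cong (2 *_) (sym edges≡E) ⟩
  2 * edges G ∎
  where
  open ≡-Reasoning
  up : Fin n → Fin n → ℕ
  up i j = 𝟙 ((toℕ i <ᵇ toℕ j) ∧ adj G i j)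
  E : ℕ
  E = ∑[ i < n ] ∑[ j < n ] up i j
  edges≡E : edges G ≡ E
  edges≡E = trans (sum-map-allFin (λ i → ListAction.sum (map (up i) (allFin n))))
                  (sum-cong-≗ λ i → sum-map-allFin (up i))
  loopless : ∀ i j → toℕ i ≡ toℕ j → adj G i j ≡ false
  loopless i j i≡j with Fin.toℕ-injective i≡j
  ... | refl = SimpleGraph.irrefl G i

module DegreeDistance {n} (G : SimpleGraph n) where
  open Distance G

  degSum : ℕ
  degSum = ∑[ i < n ] deg G i

  degDistTo distTo : Fin n → ℕ
  degDistTo r = ∑[ j < n ] (deg G j * d j r)
  distTo    r = ∑[ j < n ] d j r

  degDistSum≡ : degDistSum G ≡ ∑[ i < n ] (deg G i * degDistTo i)
  degDistSum≡ = trans (sum-map-allFin (λ i → ListAction.sum (map (term i) (allFin n))))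
                      (sum-cong-≗ λ i → trans (sum-map-allFin (term i)) (row i))
    where
    term : Fin n → Fin n → ℕ
    term i j = deg G i * deg G j * d i j
    row : ∀ i → ∑[ j < n ] term i j ≡ deg G i * degDistTo i
    row i = trans (sum-cong-≗ λ j → trans (*-assoc (deg G i) (deg G j) (d i j))
                                          (cong (λ x → deg G i * (deg G j * x)) (dist-sym i j)))
                  (sym (*-distribˡ-sum (deg G i) (λ j → deg G j * d j i)))

  ∑deg*distTo : ∑[ i < n ] (deg G i * distTo i) ≡ ∑[ r < n ] degDistTo r
  ∑deg*distTo = begin
    ∑[ i < n ] (deg G i * distTo i)           ≡⟨ sum-cong-≗ (λ i → *-distribˡ-sum (deg G i) (λ j → d j i)) ⟩
    ∑[ i < n ] ∑[ j < n ] (deg G i * d j i)   ≡⟨ ∑-comm (λ i j → deg G i * d j i) ⟩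
    ∑[ j < n ] ∑[ i < n ] (deg G i * d j i)   ≡⟨ sum-cong-≗ (λ j → sum-cong-≗ λ i → cong (deg G i *_) (dist-sym j i)) ⟩
    ∑[ r < n ] degDistTo r                    ∎
    where open ≡-Reasoning

  ∑distTo : ∑[ r < n ] distTo r ≡ wienerIndex G
  ∑distTo = ∑-comm (λ r j → d j r)

  -- weight the relation at each root r by deg r, and also sum it plainly over r
  module _ (c : ℕ) where

    degDistSum+ : degDistSum G + c * degSum ≡ ∑[ r < n ] (deg G r * (degDistTo r + c))
    degDistSum+ = begin
      degDistSum G + c * degSum
        ≡⟨ cong₂ _+_ degDistSum≡ (trans (*-distribˡ-sum c (deg G)) (sum-cong-≗ λ r → *-comm c (deg G r))) ⟩
      ∑[ r < n ] (deg G r * degDistTo r) + ∑[ r < n ] (deg G r * c)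
        ≡⟨ sym (∑-distrib-+ (λ r → deg G r * degDistTo r) (λ r → deg G r * c)) ⟩
      ∑[ r < n ] (deg G r * degDistTo r + deg G r * c)
        ≡⟨ sum-cong-≗ (λ r → sym (*-distribˡ-+ (deg G r) (degDistTo r) c)) ⟩
      ∑[ r < n ] (deg G r * (degDistTo r + c)) ∎
      where open ≡-Reasoning

    ∑-degDistTo+ : ∑[ r < n ] (degDistTo r + c) ≡ ∑[ r < n ] degDistTo r + n * c
    ∑-degDistTo+ = trans (∑-distrib-+ degDistTo (λ _ → c)) (cong (∑[ r < n ] degDistTo r +_) (sum-const n c))

    ∑deg*2distTo : ∑[ r < n ] (deg G r * (2 * distTo r)) ≡ 2 * ∑[ r < n ] degDistTo r
    ∑deg*2distTo = trans (sum-cong-≗ λ r → *-2-swap (deg G r) (distTo r))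
                         (trans (sym (*-distribˡ-sum 2 (λ r → deg G r * distTo r))) (cong (2 *_) ∑deg*distTo))
      where
      *-2-swap : ∀ a b → a * (2 * b) ≡ 2 * (a * b)
      *-2-swap a b = trans (sym (*-assoc a 2 b)) (trans (cong (_* b) (*-comm a 2)) (*-assoc 2 a b))

    degDist-identity : (∀ r → degDistTo r + c ≡ 2 * distTo r) →
                       degDistSum G + c * degSum + 2 * (n * c) ≡ 4 * wienerIndex G
    degDist-identity per-root = begin
      degDistSum G + c * degSum + 2 * (n * c)
        ≡⟨ cong (_+ 2 * (n * c)) (trans degDistSum+ (trans (sum-cong-≗ λ r → cong (deg G r *_) (per-root r)) ∑deg*2distTo)) ⟩
      2 * ∑[ r < n ] degDistTo r + 2 * (n * c)
        ≡⟨ sym (*-distribˡ-+ 2 (∑[ r < n ] degDistTo r) (n * c)) ⟩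
      2 * (∑[ r < n ] degDistTo r + n * c)
        ≡⟨ cong (2 *_) (trans (sym ∑-degDistTo+) (sum-cong-≗ per-root)) ⟩
      2 * ∑[ r < n ] (2 * distTo r)
        ≡⟨ cong (2 *_) (trans (sym (*-distribˡ-sum 2 distTo)) (cong (2 *_) ∑distTo)) ⟩
      2 * (2 * wienerIndex G)
        ≡⟨ sym (*-assoc 2 2 (wienerIndex G)) ⟩
      4 * wienerIndex G ∎
      where open ≡-Reasoning

    degDist-bound : (∀ r → 2 * distTo r ≤ degDistTo r + c) →
                    4 * wienerIndex G ≤ degDistSum G + c * degSum + 2 * (n * c)
    degDist-bound per-root = begin
      4 * wienerIndex G
        ≡⟨ *-assoc 2 2 (wienerIndex G) ⟩
      2 * (2 * wienerIndex G)
        ≡⟨ cong (2 *_) (sym (trans (sym (*-distribˡ-sum 2 distTo)) (cong (2 *_) ∑distTo))) ⟩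
      2 * ∑[ r < n ] (2 * distTo r)
        ≤⟨ *-monoʳ-≤ 2 (sum-mono-≤ per-root) ⟩
      2 * ∑[ r < n ] (degDistTo r + c)
        ≡⟨ cong (2 *_) ∑-degDistTo+ ⟩
      2 * (∑[ r < n ] degDistTo r + n * c)
        ≡⟨ *-distribˡ-+ 2 (∑[ r < n ] degDistTo r) (n * c) ⟩
      2 * ∑[ r < n ] degDistTo r + 2 * (n * c)
        ≡⟨ cong (_+ 2 * (n * c)) (sym ∑deg*2distTo) ⟩
      ∑[ r < n ] (deg G r * (2 * distTo r)) + 2 * (n * c)
        ≤⟨ +-monoˡ-≤ (2 * (n * c)) (sum-mono-≤ λ r → *-monoʳ-≤ (deg G r) (per-root r)) ⟩
      ∑[ r < n ] (deg G r * (degDistTo r + c)) + 2 * (n * c)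
        ≡⟨ cong (_+ 2 * (n * c)) (sym degDistSum+) ⟩
      degDistSum G + c * degSum + 2 * (n * c) ∎
      where open ≤-Reasoning

∑-suc-toℕ : ∀ n → 2 * ∑[ i < n ] suc (toℕ i) ≡ n * suc n
∑-suc-toℕ zero    = refl
∑-suc-toℕ (suc n) = begin
  2 * (1 + ∑[ i < n ] suc (suc (toℕ i)))           ≡⟨ cong (λ s → 2 * (1 + s)) (∑-distrib-+ {n} (λ _ → 1) (suc ∘ toℕ)) ⟩
  2 * (1 + (∑[ i < n ] 1 + ∑[ i < n ] suc (toℕ i))) ≡⟨ cong (λ s → 2 * (1 + (s + ∑[ i < n ] suc (toℕ i)))) (sum-const n 1) ⟩
  2 * (1 + (n * 1 + ∑[ i < n ] suc (toℕ i)))        ≡⟨ arith n (∑[ i < n ] suc (toℕ i)) ⟩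
  2 * ∑[ i < n ] suc (toℕ i) + 2 * suc n            ≡⟨ cong (_+ 2 * suc n) (∑-suc-toℕ n) ⟩
  n * suc n + 2 * suc n                             ≡⟨ arith′ n ⟩
  suc n * suc (suc n)                               ∎
  where
  open ≡-Reasoning
  arith : ∀ n s → 2 * (1 + (n * 1 + s)) ≡ 2 * s + 2 * suc n
  arith = solve-∀
  arith′ : ∀ n → n * suc n + 2 * suc n ≡ suc n * suc (suc n)
  arith′ = solve-∀

-- `∣ suc a - suc b ∣` reduces to `∣ a - b ∣`, so peeling off row and column 0 gives the recursion
∑∑-∣-∣ : ∀ n → 3 * ∑[ i < n ] ∑[ j < n ] ∣ toℕ i - toℕ j ∣ + n ≡ n * n * n
∑∑-∣-∣ zero    = refl
∑∑-∣-∣ (suc n) = begin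
  3 * (H + ∑[ i < n ] (suc (toℕ i) + ∑[ j < n ] ∣ toℕ i - toℕ j ∣)) + suc n
    ≡⟨ cong (λ s → 3 * (H + s) + suc n) (∑-distrib-+ {n} (suc ∘ toℕ) (λ i → ∑[ j < n ] ∣ toℕ i - toℕ j ∣)) ⟩
  3 * (H + (H + F)) + suc n
    ≡⟨ arith n H F ⟩
  3 * (2 * H) + (3 * F + n) + 1
    ≡⟨ cong₂ (λ x y → 3 * x + y + 1) (∑-suc-toℕ n) (∑∑-∣-∣ n) ⟩
  3 * (n * suc n) + n * n * n + 1
    ≡⟨ arith′ n ⟩
  suc n * suc n * suc n ∎
  where
  open ≡-Reasoning
  H F : ℕ
  H = ∑[ i < n ] suc (toℕ i)
  F = ∑[ i < n ] ∑[ j < n ] ∣ toℕ i - toℕ j ∣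
  arith : ∀ n h f → 3 * (h + (h + f)) + suc n ≡ 3 * (2 * h) + (3 * f + n) + 1
  arith = solve-∀
  arith′ : ∀ n → 3 * (n * suc n) + n * n * n + 1 ≡ suc n * suc n * suc n
  arith′ = solve-∀

path-up-edge : ∀ a b → 𝟙 ((a <ᵇ b) ∧ ((a ≡ᵇ suc b) ∨ (b ≡ᵇ suc a))) ≡ 𝟙 (b ≡ᵇ suc a)
path-up-edge zero    zero    = refl
path-up-edge zero    (suc b) = refl
path-up-edge (suc a) zero    = refl
path-up-edge (suc a) (suc b) = path-up-edge a b

∑-𝟙-pred : ∀ n c → c ≤ n → ∑[ i < n ] 𝟙 (c ≡ᵇ suc (toℕ i)) ≡ 𝟙 (0 <ᵇ c)
∑-𝟙-pred zero    zero    z≤n       = refl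
∑-𝟙-pred (suc n) zero    _         = sum-zero {n} {λ i → 𝟙 (0 ≡ᵇ suc (toℕ i))} λ _ → refl
∑-𝟙-pred (suc n) (suc c) (s≤s c≤n) = trans (cong (𝟙 (c ≡ᵇ 0) +_) (∑-𝟙-pred n c c≤n)) (exactly-one c)
  where
  exactly-one : ∀ c → 𝟙 (c ≡ᵇ 0) + 𝟙 (0 <ᵇ c) ≡ 1
  exactly-one zero    = refl
  exactly-one (suc c) = refl

module PathGraph (M : ℕ) where

  N : ℕ
  N = suc M

  P : SimpleGraph N
  P = pathGraph N

  open Distance P

  adj-pred : ∀ x y → toℕ x ≡ suc (toℕ y) → Adj P x y
  adj-pred x y x≡1+y rewrite x≡1+y | ≡ᵇ-refl (toℕ y) = refl

  walk-to-0 : ∀ t x → toℕ x ≡ t → Walk P x zero t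
  walk-to-0 zero    x x≡0 with Fin.toℕ-injective {i = x} {j = zero} x≡0
  ... | refl = nil
  walk-to-0 (suc t) x x≡1+t =
    cons (adj-pred x y (trans x≡1+t (cong suc (sym (Fin.toℕ-fromℕ< t<N))))) (walk-to-0 t y (Fin.toℕ-fromℕ< t<N))
    where
    t<N : t < N
    t<N = ≤-trans (n≤1+n (suc t)) (subst (_< N) x≡1+t (Fin.toℕ<n x))
    y : Fin N
    y = fromℕ< t<N

  connected : Connected P
  connected i j = toℕ i + toℕ j , walk-++ (walk-to-0 _ i refl) (walk-reverse (walk-to-0 _ j refl))

  ∣n-1+n∣≡1 : ∀ a → ∣ a - suc a ∣ ≡ 1
  ∣n-1+n∣≡1 zero    = refl
  ∣n-1+n∣≡1 (suc a) = ∣n-1+n∣≡1 a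

  adj⇒∣-∣≤1 : ∀ {i k} → Adj P i k → ∣ toℕ i - toℕ k ∣ ≤ 1
  adj⇒∣-∣≤1 {i} {k} i~k with ∨-true⁻ {toℕ i ≡ᵇ suc (toℕ k)} i~k
  ... | inj₁ i≡1+k rewrite ≡ᵇ-true⁻ {toℕ i} {suc (toℕ k)} i≡1+k =
    ≤-reflexive (trans (∣-∣-comm (suc (toℕ k)) (toℕ k)) (∣n-1+n∣≡1 (toℕ k)))
  ... | inj₂ k≡1+i rewrite ≡ᵇ-true⁻ {toℕ k} {suc (toℕ i)} k≡1+i = ≤-reflexive (∣n-1+n∣≡1 (toℕ i))

  walk⇒∣-∣≤ : ∀ {i j l} → Walk P i j l → ∣ toℕ i - toℕ j ∣ ≤ l
  walk⇒∣-∣≤ {i} nil = ≤-reflexive (∣n-n∣≡0 (toℕ i))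
  walk⇒∣-∣≤ {i} {j} (cons {k = k} i~k w) =
    ≤-trans (∣-∣-triangle (toℕ i) (toℕ k) (toℕ j)) (+-mono-≤ (adj⇒∣-∣≤1 {i} {k} i~k) (walk⇒∣-∣≤ w))

  ∣-∣≤dist : ∀ i j → ∣ toℕ i - toℕ j ∣ ≤ d i j
  ∣-∣≤dist i j with dist-junk⊎walk i j
  ... | inj₁ d≡N = ≤-trans (∣m-n∣≤m⊔n (toℕ i) (toℕ j))
                    (≤-trans (⊔-lub (<⇒≤ (Fin.toℕ<n i)) (<⇒≤ (Fin.toℕ<n j))) (≤-reflexive (sym d≡N)))
  ... | inj₂ w   = walk⇒∣-∣≤ w

  edges-path : edges P ≡ M
  edges-path = begin
    edges P
      ≡⟨ trans (sum-map-allFin (λ i → ListAction.sum (map (up i) (allFin N)))) (sum-cong-≗ λ i → sum-map-allFin (up i)) ⟩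
    ∑[ i < N ] ∑[ j < N ] up i j
      ≡⟨ sum-cong-≗ (λ i → sum-cong-≗ {x = up i} λ j → path-up-edge (toℕ i) (toℕ j)) ⟩
    ∑[ i < N ] ∑[ j < N ] 𝟙 (toℕ j ≡ᵇ suc (toℕ i))
      ≡⟨ ∑-comm {N} {N} (λ i j → 𝟙 (toℕ j ≡ᵇ suc (toℕ i))) ⟩
    ∑[ j < N ] ∑[ i < N ] 𝟙 (toℕ j ≡ᵇ suc (toℕ i))
      ≡⟨ sum-cong-≗ (λ j → ∑-𝟙-pred N (toℕ j) (<⇒≤ (Fin.toℕ<n j))) ⟩
    ∑[ j < N ] 𝟙 (0 <ᵇ toℕ j)
      ≡⟨ trans (sum-const M 1) (*-identityʳ M) ⟩
    M ∎
    where
    open ≡-Reasoning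
    up : Fin N → Fin N → ℕ
    up i j = 𝟙 ((toℕ i <ᵇ toℕ j) ∧ adj P i j)

  wienerIndex-path≥ : M * suc M * suc (suc M) ≤ 3 * wienerIndex P
  wienerIndex-path≥ = begin
    M * suc M * suc (suc M)                           ≡⟨ +-cancelʳ-≡ N _ _ (trans (arith M) (sym (∑∑-∣-∣ N))) ⟩
    3 * ∑[ i < N ] ∑[ j < N ] ∣ toℕ i - toℕ j ∣       ≤⟨ *-monoʳ-≤ 3 (sum-mono-≤ λ i → sum-mono-≤ λ j → ∣-∣≤dist i j) ⟩
    3 * wienerIndex P                                 ∎
    where
    open ≤-Reasoning
    arith : ∀ M → M * suc M * suc (suc M) + suc M ≡ suc M * suc M * suc M
    arith = solve-∀

kemeny : ℕ → ℕ → ℚ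
kemeny zero    _ = 0ℚ
kemeny (suc d) s = ℤ+ s / suc d

kemenyTree≡kemeny : ∀ {n} (G : SimpleGraph n) → kemenyTree G ≡ kemeny (4 * edges G) (degDistSum G)
kemenyTree≡kemeny G with 4 * edges G
... | zero  = refl
... | suc d = refl

kemeny-monoʳ-≤ : ∀ e {s t} → s ≤ t → kemeny e s ≤ℚ kemeny e t
kemeny-monoʳ-≤ zero    _   = ℚ.≤-refl
kemeny-monoʳ-≤ (suc d) {s} {t} s≤t = ℚ.toℚᵘ-cancel-≤
  (ℚᵘ.≤-respʳ-≃ (ℚᵘ.≃-sym (ℚ.toℚᵘ-fromℚᵘ (mkℚᵘ (ℤ+ t) d)))
    (ℚᵘ.≤-respˡ-≃ (ℚᵘ.≃-sym (ℚ.toℚᵘ-fromℚᵘ (mkℚᵘ (ℤ+ s) d)))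
      (*≤* (ℤ.*-monoʳ-≤-nonNeg (ℤ+ (suc d)) (+≤+ s≤t)))))

kemenyTree-mono : ∀ {m n} (G : SimpleGraph m) (H : SimpleGraph n) →
                  edges G ≡ edges H → degDistSum G ≤ degDistSum H → kemenyTree G ≤ℚ kemenyTree H
kemenyTree-mono G H edges≡ sum≤ =
  subst₂ _≤ℚ_ (sym (kemenyTree≡kemeny G)) (sym (kemenyTree≡kemeny H))
    (subst (λ e → kemeny (4 * e) (degDistSum G) ≤ℚ kemeny (4 * edges H) (degDistSum H)) (sym edges≡)
      (kemeny-monoʳ-≤ (4 * edges H) sum≤))

wienerIndex≤path : ∀ {M} (G : SimpleGraph (suc M)) → Connected G → wienerIndex G ≤ wienerIndex (pathGraph (suc M))
wienerIndex≤path {M} G conn =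
  *-cancelˡ-≤ 3 (≤-trans (WienerBound.wienerIndex≤ G conn) (PathGraph.wienerIndex-path≥ M))

module TreeVersusPath {M : ℕ} (T : SimpleGraph (suc M)) (conn : Connected T) (acyclic : Acyclic T) where

  N : ℕ
  N = suc M

  P : SimpleGraph N
  P = pathGraph N

  open DegreeDistance using (degSum; degDist-identity; degDist-bound)

  degSum-tree : degSum T ≡ 2 * M
  degSum-tree = Trees.degSum-tree T conn acyclic zero

  degSum-path : degSum P ≡ 2 * M
  degSum-path = trans (handshake P) (cong (2 *_) (PathGraph.edges-path M))

  edges-tree≡path : edges T ≡ edges P
  edges-tree≡path = trans (*-cancelˡ-≡ (edges T) M 2 (trans (sym (handshake T)) degSum-tree))
                          (sym (PathGraph.edges-path M))

  degDistSum-tree≤path : degDistSum T ≤ degDistSum P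
  degDistSum-tree≤path = +-cancelʳ-≤ E (degDistSum T) (degDistSum P) (begin
    degDistSum T + E                           ≡⟨ +-assoc (degDistSum T) _ _ ⟨
    degDistSum T + M * degSum T + 2 * (N * M)  ≡⟨ degDist-identity T M (Trees.degLevelSum-tree T conn acyclic) ⟩
    4 * wienerIndex T                          ≤⟨ *-monoʳ-≤ 4 (wienerIndex≤path T conn) ⟩
    4 * wienerIndex P                          ≤⟨ degDist-bound P M (Levels.degLevelSum-lower P (PathGraph.connected M)) ⟩
    degDistSum P + M * degSum P + 2 * (N * M)  ≡⟨ +-assoc (degDistSum P) _ _ ⟩
    degDistSum P + (M * degSum P + 2 * (N * M)) ≡⟨ cong (λ D → degDistSum P + (M * D + 2 * (N * M))) (trans degSum-path (sym degSum-tree)) ⟩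
    degDistSum P + E                           ∎)
    where
    open ≤-Reasoning
    E : ℕ
    E = M * degSum T + 2 * (N * M)

theorem3p8 : (n : ℕ) → 2 ≤ n → (T : SimpleGraph n) → IsTree T →
    kemenyTree T ≤ℚ kemenyTree (pathGraph n)
theorem3p8 zero    () _ _
theorem3p8 (suc M) _  T (conn , acyclic) =
  kemenyTree-mono T (pathGraph (suc M)) edges-tree≡path degDistSum-tree≤path
  where open TreeVersusPath T conn acyclic
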